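{- Let $A$ and $B$ be finite sets of primes with $|B|\le|A|$. If $B\subset A$, or if $\min(B\setminus A)>\max(A)$, then $D(B,A)\ge 1$.
   Context: For finite sets of primes $A,B$, $D(A,B)=\left(\prod_{q\in A}\frac{q-1}{q}\right)\left(\prod_{q\in B}\frac{q}{q-1}\right)$. -}

module Defs where

open import Data.Nat using (ℕ; zero; suc; _∸_)
open import Data.Integer using (+_)
open import Data.Rational using (ℚ; _/_; _*_; 0ℚ; 1ℚ)
open import Data.List using (List; foldr; map)

-- the rational a / d; junk value 0 when d = 0 (never used: all q are primes)
frac : ℕ → ℕ → ℚ
frac a zero    = 0ℚ
frac a (suc d) = (+ a) / suc d

prodℚ : List ℚ → ℚ
prodℚ = foldr _*_ 1ℚ

-- D(A,B) = (∏_{q∈A} (q-1)/q) (∏_{q∈B} q/(q-1)),  finite sets given as duplicate-free lists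
D : List ℕ → List ℕ → ℚ
D A B = prodℚ (map (λ q → frac (q ∸ 1) q) A) * prodℚ (map (λ q → frac q (q ∸ 1)) B)

-- With P(L) = ∏_{q ∈ L} (q - 1)/q we have D(B,A) = P(B)/P(A), so it suffices that
-- P(A) ≤ P(B).  Pair each b ∈ B with a distinct element of A: with b itself when
-- b ∈ A, and otherwise with the largest element of A not yet used, which is
-- smaller than b.  As q ↦ (q - 1)/q is increasing, each factor of P(B) dominates
-- its partner in P(A), and the factors of P(A) left unpaired are at most 1.
module Submission where

open import Defs
open import Data.Nat using (ℕ; _<_)
open import Data.Nat.Primality using (Prime)
open import Data.List using (List; length)
open import Data.List.Relation.Unary.All using (All)
open import Data.List.Relation.Unary.Unique.Propositional using (Unique)
open import Data.List.Membership.Propositional using (_∈_; _∉_)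
open import Data.List.Relation.Binary.Subset.Propositional using (_⊆_)
open import Data.Rational using (1ℚ; _≤_)
open import Data.Sum using (_⊎_)
import Data.Nat as N

open import Function using (id)
open import Data.Nat using (zero; suc; _∸_; s≤s; nonTrivial⇒n>1)
import Data.Nat.Properties as ℕₚ
open import Data.Nat.Primality using (prime⇒nonTrivial)
open import Data.List using ([]; _∷_; foldr; map)
open import Data.List.Properties using (length-removeAt′)
open import Data.List.Relation.Unary.All using ([]; _∷_; lookup; tabulate)
import Data.List.Relation.Unary.All as All
open import Data.List.Relation.Unary.All.Properties using (─⁺; All¬⇒¬Any)
open import Data.List.Relation.Unary.Any using (here; there; _─_; index)
open import Data.List.Relation.Unary.AllPairs using ([]; _∷_)
open import Data.List.Membership.DecPropositional ℕₚ._≟_ using (_∈?_)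
open import Data.List.Extrema.Nat using (max; argmax-all; ⊥≤max; xs≤max)
open import Data.Sum using ([_,_]′)
open import Relation.Nullary using (Dec; yes; no; contradiction)
open import Relation.Binary.PropositionalEquality
  using (_≡_; _≢_; refl; sym; cong; subst; subst₂; ≢-sym; module ≡-Reasoning)
import Data.Integer as ℤ
open import Data.Integer using (+_; +≤+)
open import Data.Integer.Properties using (pos-*)
import Data.Rational as ℚ
open import Data.Rational.Properties using (toℚᵘ-cancel-≤; toℚᵘ-fromℚᵘ; toℚᵘ-homo-*)
open import Data.Rational.Unnormalised
  using (ℚᵘ; mkℚᵘ; 0ℚᵘ; 1ℚᵘ; NonNegative; *≤*; *≡*)
  renaming (_*_ to _·_; _≤_ to _≤ᵘ_; _≃_ to _≃ᵘ_)
open import Data.Rational.Unnormalised.Properties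
  using (≃-refl; ≃-trans; *-cong; *-congˡ; *-identityˡ;
         *-monoˡ-≤-nonNeg; *-mono-≤-nonNeg; nonNegative⁻¹; nonNeg*nonNeg⇒nonNeg;
         *-1-commutativeMonoid; module ≤-Reasoning)
  renaming (≤-refl to ≤ᵘ-refl)
open import Algebra.Bundles using (CommutativeMonoid)
open import Algebra.Properties.CommutativeSemigroup
  (CommutativeMonoid.commutativeSemigroup *-1-commutativeMonoid) using (x∙yz≈y∙xz; interchange)

-- The arithmetic is done in ℚᵘ, where a / d is the unreduced mkℚᵘ a (d - 1), so that
-- comparisons are plain cross-multiplications.
fracᵘ : ℕ → ℕ → ℚᵘ
fracᵘ a zero    = 0ℚᵘ
fracᵘ a (suc d) = mkℚᵘ (+ a) d

∏ᵘ : List ℚᵘ → ℚᵘ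
∏ᵘ = foldr _·_ 1ℚᵘ

toℚᵘ-frac : ∀ a d → ℚ.toℚᵘ (frac a d) ≃ᵘ fracᵘ a d
toℚᵘ-frac a zero    = ≃-refl
toℚᵘ-frac a (suc d) = toℚᵘ-fromℚᵘ (mkℚᵘ (+ a) d)

toℚᵘ-prodℚ-map : (h : ℕ → ℚ.ℚ) (hᵘ : ℕ → ℚᵘ) → (∀ x → ℚ.toℚᵘ (h x) ≃ᵘ hᵘ x) →
  ∀ xs → ℚ.toℚᵘ (prodℚ (map h xs)) ≃ᵘ ∏ᵘ (map hᵘ xs)
toℚᵘ-prodℚ-map h hᵘ h≃hᵘ []       = ≃-refl
toℚᵘ-prodℚ-map h hᵘ h≃hᵘ (x ∷ xs) = ≃-trans (toℚᵘ-homo-* (h x) (prodℚ (map h xs)))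
  (*-cong (h≃hᵘ x) (toℚᵘ-prodℚ-map h hᵘ h≃hᵘ xs))

fracᵘ-nonNeg : ∀ a d → NonNegative (fracᵘ a d)
fracᵘ-nonNeg a zero    = _
fracᵘ-nonNeg a (suc d) = _

fracᵘ-≤ : ∀ {a b d e} → a N.* suc e N.≤ b N.* suc d → fracᵘ a (suc d) ≤ᵘ fracᵘ b (suc e)
fracᵘ-≤ {a} {b} {d} {e} h =
  *≤* (subst₂ ℤ._≤_ (pos-* a (suc e)) (pos-* b (suc d)) (+≤+ h))

down up : ℕ → ℚᵘ
down q = fracᵘ (q ∸ 1) q
up   q = fracᵘ q (q ∸ 1)

down-nonNeg : ∀ q → NonNegative (down q)
down-nonNeg q = fracᵘ-nonNeg (q ∸ 1) q

up-nonNeg : ∀ q → NonNegative (up q)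
up-nonNeg q = fracᵘ-nonNeg q (q ∸ 1)

down-≤1 : ∀ q → down q ≤ᵘ 1ℚᵘ
down-≤1 zero          = nonNegative⁻¹ 1ℚᵘ
down-≤1 (suc zero)    = nonNegative⁻¹ 1ℚᵘ
down-≤1 (suc (suc k)) = fracᵘ-≤ (subst₂ N._≤_
  (sym (ℕₚ.*-identityʳ (suc k))) (sym (ℕₚ.*-identityˡ (suc (suc k)))) (ℕₚ.n≤1+n (suc k)))

down-mono : ∀ {p q} → p N.≤ q → down p ≤ᵘ down q
down-mono {zero}        {q}           _   = nonNegative⁻¹ (down q) {{down-nonNeg q}}
down-mono {suc zero}    {q}           _   = nonNegative⁻¹ (down q) {{down-nonNeg q}}
down-mono {suc (suc i)} {suc (suc j)} (s≤s (s≤s i≤j)) = fracᵘ-≤ (begin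
  suc i N.* suc (suc j)     ≡⟨ ℕₚ.*-suc (suc i) (suc j) ⟩
  suc i N.+ suc i N.* suc j ≤⟨ ℕₚ.+-monoˡ-≤ (suc i N.* suc j) (s≤s i≤j) ⟩
  suc j N.+ suc i N.* suc j ≡⟨ cong (suc j N.+_) (ℕₚ.*-comm (suc i) (suc j)) ⟩
  suc j N.+ suc j N.* suc i ≡⟨ ℕₚ.*-suc (suc j) (suc i) ⟨
  suc j N.* suc (suc i)     ∎)
  where open ℕₚ.≤-Reasoning

down·up≃1 : ∀ q → 1 < q → down q · up q ≃ᵘ 1ℚᵘ
down·up≃1 (suc zero) (s≤s ())
down·up≃1 (suc (suc k)) _ = *≡* (cong +_ (begin
  suc k N.* suc (suc k) N.* 1 ≡⟨ ℕₚ.*-identityʳ _ ⟩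
  suc k N.* suc (suc k)       ≡⟨ ℕₚ.*-comm (suc k) (suc (suc k)) ⟩
  suc (suc k) N.* suc k       ≡⟨ ℕₚ.*-identityˡ _ ⟨
  1 N.* (suc (suc k) N.* suc k) ∎))
  where open ≡-Reasoning

module _ {y : ℕ} where

  ∈-─⁻ : ∀ {z xs} (p : y ∈ xs) → z ∈ (xs ─ p) → z ∈ xs
  ∈-─⁻ (here _)  z∈         = there z∈
  ∈-─⁻ (there p) (here z≡)  = here z≡
  ∈-─⁻ (there p) (there z∈) = there (∈-─⁻ p z∈)

  ∈-─⁺ : ∀ {z xs} (p : y ∈ xs) → z ∈ xs → z ≢ y → z ∈ (xs ─ p)
  ∈-─⁺ (here refl) (here z≡y)  z≢y = contradiction z≡y z≢y
  ∈-─⁺ (here refl) (there z∈)  _   = z∈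
  ∈-─⁺ (there p)   (here z≡)   _   = here z≡
  ∈-─⁺ (there p)   (there z∈)  z≢y = there (∈-─⁺ p z∈ z≢y)

  ∈-─⇒≢ : ∀ {z xs} → Unique xs → (p : y ∈ xs) → z ∈ (xs ─ p) → z ≢ y
  ∈-─⇒≢ (x≢xs ∷ _) (here refl) z∈         = ≢-sym (lookup x≢xs z∈)
  ∈-─⇒≢ (x≢xs ∷ _) (there p)   (here refl) = lookup x≢xs p
  ∈-─⇒≢ (_ ∷ uxs)  (there p)   (there z∈)  = ∈-─⇒≢ uxs p z∈

  Unique-─ : ∀ {xs} (p : y ∈ xs) → Unique xs → Unique (xs ─ p)
  Unique-─ (here _)  (_ ∷ uxs)    = uxs
  Unique-─ (there p) (x≢xs ∷ uxs) = ─⁺ p x≢xs ∷ Unique-─ p uxs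

  length-─ : ∀ {xs} (p : y ∈ xs) → length xs ≡ suc (length (xs ─ p))
  length-─ {xs} p = length-removeAt′ xs (index p)

  ∏ᵘ-map-─ : ∀ (f : ℕ → ℚᵘ) {xs} (p : y ∈ xs) → ∏ᵘ (map f xs) ≃ᵘ f y · ∏ᵘ (map f (xs ─ p))
  ∏ᵘ-map-─ f (here refl)        = ≃-refl
  ∏ᵘ-map-─ f {x ∷ xs} (there p) = ≃-trans (*-congˡ {f x} (∏ᵘ-map-─ f p))
    (x∙yz≈y∙xz (f x) (f y) (∏ᵘ (map f (xs ─ p))))

max-∈ : ∀ x xs → max x xs ∈ x ∷ xs
max-∈ x xs = argmax-all id (here refl) (tabulate there)

max-upper : ∀ x xs → All (N._≤ max x xs) (x ∷ xs)
max-upper x xs = ⊥≤max x xs ∷ xs≤max x xs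

Dominates : List ℕ → List ℕ → Set
Dominates B A = ∀ b → b ∈ B → b ∉ A → ∀ a → a ∈ A → a < b

⊆⇒Dominates : ∀ {A B} → B ⊆ A → Dominates B A
⊆⇒Dominates B⊆A b b∈B b∉A = contradiction (B⊆A b∈B) b∉A

Dominates-─-shared : ∀ {A B b} (p : b ∈ A) → b ∉ B → Dominates B A → Dominates B (A ─ p)
Dominates-─-shared p b∉B dom c c∈B c∉A─p a a∈A─p =
  dom c c∈B (λ c∈A → c∉A─p (∈-─⁺ p c∈A (λ { refl → b∉B c∈B }))) a (∈-─⁻ p a∈A─p)

Dominates-─-max : ∀ {A B m} → Unique A → (p : m ∈ A) → All (N._≤ m) A →
  Dominates B A → Dominates B (A ─ p)
Dominates-─-max {m = m} uA p A≤m dom c c∈B c∉A─p a a∈A─p with c ℕₚ.≟ m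
... | yes refl = ℕₚ.≤∧≢⇒< (lookup A≤m (∈-─⁻ p a∈A─p)) (∈-─⇒≢ uA p a∈A─p)
... | no c≢m   = dom c c∈B (λ c∈A → c∉A─p (∈-─⁺ p c∈A c≢m)) a (∈-─⁻ p a∈A─p)

∏ᵘ-map-nonNeg : ∀ (f : ℕ → ℚᵘ) → (∀ x → NonNegative (f x)) →
  ∀ xs → NonNegative (∏ᵘ (map f xs))
∏ᵘ-map-nonNeg f f-nonNeg []       = _
∏ᵘ-map-nonNeg f f-nonNeg (x ∷ xs) =
  nonNeg*nonNeg⇒nonNeg (f x) {{f-nonNeg x}} (∏ᵘ (map f xs)) {{∏ᵘ-map-nonNeg f f-nonNeg xs}}

module _ (f : ℕ → ℚᵘ) (f-nonNeg : ∀ x → NonNegative (f x)) (f-≤1 : ∀ x → f x ≤ᵘ 1ℚᵘ)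
         (f-mono : ∀ {x y} → x N.≤ y → f x ≤ᵘ f y) where

  ∏ᵘ-map-≤1 : ∀ xs → ∏ᵘ (map f xs) ≤ᵘ 1ℚᵘ
  ∏ᵘ-map-≤1 []       = ≤ᵘ-refl
  ∏ᵘ-map-≤1 (x ∷ xs) = *-mono-≤-nonNeg {{f-nonNeg x}} {{∏ᵘ-map-nonNeg f f-nonNeg xs}}
    (f-≤1 x) (∏ᵘ-map-≤1 xs)

  ∏ᵘ-map-≤-of-Dominates : ∀ A B → Unique A → Unique B → length B N.≤ length A →
    Dominates B A → ∏ᵘ (map f A) ≤ᵘ ∏ᵘ (map f B)
  ∏ᵘ-map-≤-of-Dominates A        []      _  _          _   _   = ∏ᵘ-map-≤1 A
  ∏ᵘ-map-≤-of-Dominates []       (b ∷ B) _  _          ()  _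
  ∏ᵘ-map-≤-of-Dominates (x ∷ xs) (b ∷ B) uA (b≢B ∷ uB) len dom = partner (b ∈? x ∷ xs)
    where
    A = x ∷ xs

    dom′ : Dominates B A
    dom′ c c∈B = dom c (there c∈B)

    pair : ∀ {y} (p : y ∈ A) → f y ≤ᵘ f b → Dominates B (A ─ p) →
           ∏ᵘ (map f A) ≤ᵘ f b · ∏ᵘ (map f B)
    pair {y} p fy≤fb dom-p = begin
      ∏ᵘ (map f A)             ≃⟨ ∏ᵘ-map-─ f p ⟩
      f y · ∏ᵘ (map f (A ─ p)) ≤⟨ *-mono-≤-nonNeg {{f-nonNeg y}} {{∏ᵘ-map-nonNeg f f-nonNeg (A ─ p)}}
                                                   fy≤fb rest ⟩
      f b · ∏ᵘ (map f B)       ∎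
      where
      open ≤-Reasoning
      rest = ∏ᵘ-map-≤-of-Dominates (A ─ p) B (Unique-─ p uA) uB
               (ℕₚ.≤-pred (subst (suc (length B) N.≤_) (length-─ p) len)) dom-p

    partner : Dec (b ∈ A) → ∏ᵘ (map f A) ≤ᵘ f b · ∏ᵘ (map f B)
    partner (yes b∈A) = pair b∈A ≤ᵘ-refl (Dominates-─-shared b∈A (All¬⇒¬Any b≢B) dom′)
    partner (no b∉A)  = pair m∈A (f-mono (ℕₚ.<⇒≤ (dom b (here refl) b∉A _ m∈A)))
                             (Dominates-─-max uA m∈A (max-upper x xs) dom′)
      where m∈A = max-∈ x xs

toℚᵘ-D : ∀ B A → ℚ.toℚᵘ (D B A) ≃ᵘ ∏ᵘ (map down B) · ∏ᵘ (map up A)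
toℚᵘ-D B A = ≃-trans (toℚᵘ-homo-* (prodℚ (map down′ B)) (prodℚ (map up′ A)))
  (*-cong (toℚᵘ-prodℚ-map down′ down (λ q → toℚᵘ-frac (q ∸ 1) q) B)
          (toℚᵘ-prodℚ-map up′   up   (λ q → toℚᵘ-frac q (q ∸ 1)) A))
  where
  down′ up′ : ℕ → ℚ.ℚ
  down′ q = frac (q ∸ 1) q
  up′   q = frac q (q ∸ 1)

∏-down·∏-up≃1 : ∀ xs → All (1 <_) xs → ∏ᵘ (map down xs) · ∏ᵘ (map up xs) ≃ᵘ 1ℚᵘ
∏-down·∏-up≃1 []       _           = *-identityˡ 1ℚᵘ
∏-down·∏-up≃1 (x ∷ xs) (1<x ∷ 1<xs) = ≃-trans (interchange (down x) _ (up x) _)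
  (≃-trans (*-cong (down·up≃1 x 1<x) (∏-down·∏-up≃1 xs 1<xs)) (*-identityˡ 1ℚᵘ))

prime⇒>1 : ∀ {p} → Prime p → 1 < p
prime⇒>1 {p} p-prime = nonTrivial⇒n>1 p {{prime⇒nonTrivial p-prime}}

lemma5 : (A B : List ℕ) → Unique A → Unique B → All Prime A → All Prime B →
    length B N.≤ length A →
    (B ⊆ A ⊎ (∀ b → b ∈ B → b ∉ A → ∀ a → a ∈ A → a < b)) →
    1ℚ ≤ D B A
lemma5 A B uA uB A-prime _ len B⊆A⊎dom = toℚᵘ-cancel-≤ (begin
  1ℚᵘ                             ≃⟨ ∏-down·∏-up≃1 A (All.map prime⇒>1 A-prime) ⟨
  ∏ᵘ (map down A) · ∏ᵘ (map up A) ≤⟨ *-monoˡ-≤-nonNeg (∏ᵘ (map up A))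
                                       {{∏ᵘ-map-nonNeg up up-nonNeg A}} P[A]≤P[B] ⟩
  ∏ᵘ (map down B) · ∏ᵘ (map up A) ≃⟨ toℚᵘ-D B A ⟨
  ℚ.toℚᵘ (D B A)                  ∎)
  where
  open ≤-Reasoning
  P[A]≤P[B] : ∏ᵘ (map down A) ≤ᵘ ∏ᵘ (map down B)
  P[A]≤P[B] = ∏ᵘ-map-≤-of-Dominates down down-nonNeg down-≤1 down-mono A B uA uB len
                ([ ⊆⇒Dominates , id ]′ B⊆A⊎dom)
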